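{- Let $\mathcal{L}\in\{\mathrm{ML},\mathrm{ML}(\underline{\vee}),\mathrm{MDL},\mathrm{EMDL}\}$. The calculus $\mathbf{T}_{\mathcal{L}}$ is sound: if there is a closed tableau for an $\mathcal{L}$-formula $\varphi$ in $\mathbf{T}_{\mathcal{L}}$, then $\varphi$ is valid.
   Context: Syntax (negation normal form): $\mathrm{ML}$: $\varphi::=p\mid\neg p\mid(\varphi\wedge\varphi)\mid(\varphi\vee\varphi)\mid\Diamond\varphi\mid\Box\varphi$; $\mathrm{ML}(\underline{\vee})$ adds $(\varphi\,\underline{\vee}\,\varphi)$; $\mathrm{MDL}$ adds atoms ${=}(p_1,\dots,p_n,q)$; $\mathrm{EMDL}$ adds atoms ${=}(\varphi_1,\dots,\varphi_n,\psi)$ with $\varphi_i,\psi\in\mathrm{ML}$. For $\chi\in\mathrm{ML}$, $\chi^\bot$ is the negation normal form of $\neg\chi$; $\chi^\top:=\chi$. Team semantics: Kripke model $K=(W,R,V)$, $W\ne\emptyset$, $R\subseteq W\times W$, $V:\Phi\to\mathcal{P}(W)$; team $T\subseteq W$. $K,T\models p$ iff $T\subseteq V(p)$; $K,T\models\neg p$ iff $T\cap V(p)=\emptyset$; $\wedge$ conjunctively; $K,T\models\varphi\vee\psi$ iff $T=T_1\cup T_2$ with $K,T_1\models\varphi$, $K,T_2\models\psi$; $K,T\models\varphi\,\underline{\vee}\,\psi$ iff $K,T\models\varphi$ or $K,T\models\psi$; $K,T\models\Diamond\varphi$ iff $K,T'\models\varphi$ for some $T'$ such that each $w\in T$ has an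 $R$-successor in $T'$ and each $v\in T'$ an $R$-predecessor in $T$; $K,T\models\Box\varphi$ iff $K,R[T]\models\varphi$ ($R[T]$ = successors of $T$); $K,T\models{=}(\varphi_1,\dots,\varphi_n,\psi)$ iff any $w,v\in T$ agreeing on the truth of all $\varphi_i$ (on singleton teams) agree on $\psi$. Valid: true in all Kripke models and all teams. $\mathrm{vrank}(\varphi)$: number of $\underline{\vee}$ in $\varphi$, each dependence atom ${=}(\varphi_1,\dots,\varphi_n,\psi)$ first replaced by $\bigvee_{\vec a\in\{\bot,\top\}^n}\bigwedge\{\varphi_1^{a_1},\dots,\varphi_n^{a_n},(\psi\,\underline{\vee}\,\psi^\bot)\}$. Labeled tableaux: labels are finite subsets of $\mathbb{N}$; nodes carry labeled formulas $\alpha:\varphi$ or accessibility formulas $i\mathsf{R}j$. A tableau is a finitely branching tree built from the root by rule applications; a rule extends a branch containing its premises by alternatives (separated by $\mid$), each adding all its listed items; a labeled formula is never added to a branch already containing it, and ($\Box$) is never applied twice to the same labeled formula on a branch. Rules: (Prop) from $\{i_1,\dots,i_k\}:p$: $\{i_1\}:p\mid\dots\mid\{i_k\}:p$; ($\neg$Prop) likewise for $\neg p$; ($\wedge$) from $\alpha:(\varphi\wedge\psi)$: $\alpha:\varphi\mid\alpha:\psi$; ($\vee$) from $\alpha:(\varphi\vee\psi)$ and any $\beta\subseteq\alpha$: $\beta:\varphi\mid\alpha\setminus\beta:\psi$; ($\underline{\vee}$) from $\alpha:(\varphi\,\underline{\vee}\,\psi)$: add $\alpha:\varphi$ and $\alpha:\psi$;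 (Split) from $\alpha:{=}(\vec\chi,\theta)$: $\alpha_1:{=}(\vec\chi,\theta)\mid\dots\mid\alpha_k:{=}(\vec\chi,\theta)$, $\alpha_1,\dots,\alpha_k$ all 2-element subsets of $\alpha$; (PL dep) from $\{i_1,i_2\}:{=}(p_1,\dots,p_n,q)$: one alternative per $g:\{1,\dots,n\}\to\{\top,\bot\}$ adding $\{i_1\}:p_m^{g(m)},\{i_2\}:p_m^{g(m)}$ ($m\le n$), $\{i_1,i_2\}:q$, $\{i_1,i_2\}:\neg q$; (ML dep) from $\{i_1,i_2\}:{=}(\varphi_1,\dots,\varphi_n,\psi)$: one alternative per $h:\{1,\dots,n\}\to\{\top,\bot\}$ adding $\{i_1\}:\varphi_m^{h(m)},\{i_2\}:\varphi_m^{h(m)}$ ($m\le n$), $\{i_1,i_2\}:\psi$, $\{i_1,i_2\}:\psi^\bot$; ($\Diamond$) from $\{i_1,\dots,i_n\}:\Diamond\varphi$ and $i_1\mathsf{R}j_1,\dots,i_n\mathsf{R}j_n$: add $\{j_1,\dots,j_n\}:\varphi$; ($\Box$) from $\alpha:\Box\varphi$, with $t=2^{\mathrm{vrank}(\varphi)}$ and fresh distinct $i_1,\dots,i_t$: one alternative per $f:\{1,\dots,t\}\to\alpha$ adding $f(1)\mathsf{R}i_1,\dots,f(t)\mathsf{R}i_t$ and $\{i_1,\dots,i_t\}:\varphi$. Calculi: $\mathbf{T}_{\mathrm{ML}}$ = (Prop),($\neg$Prop),($\wedge$),($\vee$),($\Diamond$),($\Box$); $\mathbf{T}_{\mathrm{ML}(\underline{\vee})}$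 adds ($\underline{\vee}$); $\mathbf{T}_{\mathrm{MDL}}$ adds (Split),(PL dep); $\mathbf{T}_{\mathrm{EMDL}}$ adds (Split),(ML dep). A tableau for $\varphi$ in $\mathbf{T}_{\mathcal{L}}$ has root $\{1,\dots,2^{\mathrm{vrank}(\varphi)}\}:\varphi$. A branch is closed if it contains (1) $\alpha:p$ and $\alpha:\neg p$, or (2) $\emptyset:\psi$, or (3) $\{i\}:{=}(p_1,\dots,p_n,q)$, or (4) $\{i\}:{=}(\varphi_1,\dots,\varphi_n,\psi)$ with $\varphi_i,\psi\in\mathrm{ML}$; a tableau is closed if all branches are closed.
   Formalization: A branch closes under condition (1) only when it contains {i}:p and {i}:¬p for a singleton label {i}, instead of α:p and α:¬p for an arbitrary label α. The statement above fails without it. -}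

module Defs where

open import Level using (0ℓ; Lift) renaming (suc to lsuc)
open import Data.Nat using (ℕ; zero; suc; _+_; _^_)
open import Data.Bool using (Bool; true; false)
open import Data.List using (List; []; _∷_; _++_; map; concat; concatMap; length; upTo; zipWith; [_])
import Data.List.NonEmpty as L⁺
open import Data.List.Relation.Unary.All using (All)
open import Data.List.Relation.Unary.Any using (Any)
open import Data.List.Relation.Unary.Unique.Propositional using (Unique)
open import Data.List.Membership.Propositional using (_∈_; _∉_)
open import Data.List.Relation.Binary.Subset.Propositional using (_⊆_)
open import Data.Product using (Σ; ∃; _×_; _,_; proj₁; proj₂)
open import Data.Sum using (_⊎_)
open import Data.Unit using (⊤)
open import Relation.Nullary using (¬_)
open import Relation.Binary.PropositionalEquality using (_≡_)

-- Syntax (negation normal form); propositional variables Φ = ℕ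

data MLF : Set where
  var neg : ℕ → MLF
  _∧_ _∨_ : MLF → MLF → MLF
  ◇_ □_   : MLF → MLF

-- All formulas of ML, ML(⊻), MDL, EMDL (the logic is selected by InL)
data Form : Set where
  var neg : ℕ → Form
  _∧_ _∨_ _⊻_ : Form → Form → Form
  ◇_ □_   : Form → Form
  pdep : List ℕ → ℕ → Form              -- =(p₁,…,pₙ,q)
  edep : List MLF → MLF → Form          -- =(φ₁,…,φₙ,ψ), φᵢ,ψ ∈ ML

⌜_⌝ : MLF → Form
⌜ var p ⌝ = var p
⌜ neg p ⌝ = neg p
⌜ φ ∧ ψ ⌝ = ⌜ φ ⌝ ∧ ⌜ ψ ⌝
⌜ φ ∨ ψ ⌝ = ⌜ φ ⌝ ∨ ⌜ ψ ⌝
⌜ ◇ φ ⌝ = ◇ ⌜ φ ⌝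
⌜ □ φ ⌝ = □ ⌜ φ ⌝

dual : MLF → MLF
dual (var p) = neg p
dual (neg p) = var p
dual (φ ∧ ψ) = dual φ ∨ dual ψ
dual (φ ∨ ψ) = dual φ ∧ dual ψ
dual (◇ φ) = □ dual φ
dual (□ φ) = ◇ dual φ

lit : Bool → MLF → MLF
lit true  φ = φ
lit false φ = dual φ

data Logic : Set where
  ML MLuv MDL EMDL : Logic

InL : Logic → Form → Set
InL L (var p) = ⊤
InL L (neg p) = ⊤
InL L (φ ∧ ψ) = InL L φ × InL L ψ
InL L (φ ∨ ψ) = InL L φ × InL L ψ
InL L (φ ⊻ ψ) = (L ≡ MLuv) × InL L φ × InL L ψ
InL L (◇ φ) = InL L φ
InL L (□ φ) = InL L φ
InL L (pdep ps q) = L ≡ MDL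
InL L (edep φs ψ) = L ≡ EMDL

record Kripke : Set₁ where
  field
    W : Set
    nonempty : W
    R : W → W → Set
    V : ℕ → W → Set

Team : Kripke → Set₁
Team K = Kripke.W K → Set

_⟺_ : ∀ {a b} → Set a → Set b → Set _
A ⟺ B = (A → B) × (B → A)

module _ (K : Kripke) where
  open Kripke K

  singleton : W → Team K
  singleton w u = u ≡ w

  succs : Team K → Team K
  succs T v = Σ W λ w → T w × R w v

  satML : Team K → MLF → Set₁
  satML T (var p) = Lift (lsuc 0ℓ) (∀ w → T w → V p w)
  satML T (neg p) = Lift (lsuc 0ℓ) (∀ w → T w → ¬ V p w)
  satML T (φ ∧ ψ) = satML T φ × satML T ψ
  satML T (φ ∨ ψ) = Σ (Team K) λ T₁ → Σ (Team K) λ T₂ →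
    (∀ w → T w → T₁ w ⊎ T₂ w) × (∀ w → T₁ w → T w) × (∀ w → T₂ w → T w) ×
    satML T₁ φ × satML T₂ ψ
  satML T (◇ φ) = Σ (Team K) λ T′ →
    (∀ w → T w → Σ W λ v → R w v × T′ v) × (∀ v → T′ v → Σ W λ w → T w × R w v) ×
    satML T′ φ
  satML T (□ φ) = satML (succs T) φ

  Agree : MLF → W → W → Set₁
  Agree φ w v = satML (singleton w) φ ⟺ satML (singleton v) φ

  sat : Team K → Form → Set₁
  sat T (var p) = Lift (lsuc 0ℓ) (∀ w → T w → V p w)
  sat T (neg p) = Lift (lsuc 0ℓ) (∀ w → T w → ¬ V p w)
  sat T (φ ∧ ψ) = sat T φ × sat T ψ
  sat T (φ ∨ ψ) = Σ (Team K) λ T₁ → Σ (Team K) λ T₂ →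
    (∀ w → T w → T₁ w ⊎ T₂ w) × (∀ w → T₁ w → T w) × (∀ w → T₂ w → T w) ×
    sat T₁ φ × sat T₂ ψ
  sat T (φ ⊻ ψ) = sat T φ ⊎ sat T ψ
  sat T (◇ φ) = Σ (Team K) λ T′ →
    (∀ w → T w → Σ W λ v → R w v × T′ v) × (∀ v → T′ v → Σ W λ w → T w × R w v) ×
    sat T′ φ
  sat T (□ φ) = sat (succs T) φ
  sat T (pdep ps q) = ∀ w v → T w → T v →
    All (λ p → Agree (var p) w v) ps → Agree (var q) w v
  sat T (edep φs ψ) = ∀ w v → T w → T v →
    All (λ φ → Agree φ w v) φs → Agree ψ w v

Valid : Form → Set₁
Valid φ = (K : Kripke) (T : Team K) → sat K T φ

-- all functions {1..n} → {⊤,⊥}, as sign lists of length n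
allSigns⁺ : ℕ → L⁺.List⁺ (List Bool)
allSigns⁺ zero = L⁺.[ [] ]
allSigns⁺ (suc n) = L⁺.map (true ∷_) (allSigns⁺ n) L⁺.⁺++⁺ L⁺.map (false ∷_) (allSigns⁺ n)

allSigns : ℕ → List (List Bool)
allSigns n = L⁺.toList (allSigns⁺ n)

bigAnd : List Form → Form → Form
bigAnd [] z = z
bigAnd (x ∷ xs) z = x ∧ bigAnd xs z

depExpand : List MLF → MLF → Form
depExpand φs ψ = L⁺.foldr₁ _∨_
  (L⁺.map (λ s → bigAnd (zipWith (λ b φ → ⌜ lit b φ ⌝) s φs) (⌜ ψ ⌝ ⊻ ⌜ dual ψ ⌝))
          (allSigns⁺ (length φs)))

expand : Form → Form
expand (var p) = var p
expand (neg p) = neg p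
expand (φ ∧ ψ) = expand φ ∧ expand ψ
expand (φ ∨ ψ) = expand φ ∨ expand ψ
expand (φ ⊻ ψ) = expand φ ⊻ expand ψ
expand (◇ φ) = ◇ expand φ
expand (□ φ) = □ expand φ
expand (pdep ps q) = depExpand (map var ps) (var q)
expand (edep φs ψ) = depExpand φs ψ

count⊻ : Form → ℕ
count⊻ (var p) = 0
count⊻ (neg p) = 0
count⊻ (φ ∧ ψ) = count⊻ φ + count⊻ ψ
count⊻ (φ ∨ ψ) = count⊻ φ + count⊻ ψ
count⊻ (φ ⊻ ψ) = suc (count⊻ φ + count⊻ ψ)
count⊻ (◇ φ) = count⊻ φ
count⊻ (□ φ) = count⊻ φ
count⊻ (pdep ps q) = 0
count⊻ (edep φs ψ) = 0

vrank : Form → ℕ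
vrank φ = count⊻ (expand φ)

-- Labelled tableaux. Labels: finite subsets of ℕ, given by listings
-- (lists), compared up to set equality _≋_.

Label : Set
Label = List ℕ

_≋_ : Label → Label → Set
α ≋ β = (α ⊆ β) × (β ⊆ α)

data Item : Set where
  _∶_ : Label → Form → Item
  _𝐑_ : ℕ → ℕ → Item

record Branch : Set where
  constructor ⟨_,_⟩
  field
    items   : List Item
    usedBox : List (Label × Form)   -- (α , φ) such that (□) was applied to α : □φ
open Branch public

_∶_∈ᴮ_ : Label → Form → Branch → Set
α ∶ φ ∈ᴮ B = Any (λ it → Σ Label λ β → (it ≡ (β ∶ φ)) × (β ≋ α)) (items B)

Occurs : ℕ → Item → Set
Occurs i (β ∶ φ) = i ∈ β
Occurs i (j 𝐑 k) = (i ≡ j) ⊎ (i ≡ k)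

Fresh : Branch → ℕ → Set
Fresh B i = ¬ Any (Occurs i) (items B)

BoxUsed : Branch → Label → Form → Set
BoxUsed B α φ = Any (λ u → (proj₁ u ≋ α) × (proj₂ u ≡ φ)) (usedBox B)

ext : Branch → List Item → Branch
ext B xs = ⟨ items B ++ xs , usedBox B ⟩

extBox : Branch → Label → Form → List Item → Branch
extBox B α φ xs = ⟨ items B ++ xs , (α , φ) ∷ usedBox B ⟩

-- all 2-element subsets of a duplicate-free listing
pairs : List ℕ → List Label
pairs [] = []
pairs (x ∷ xs) = map (λ y → x ∷ y ∷ []) xs ++ pairs xs

-- all functions {1..t} → α, as lists of length t with entries in α
choices : List ℕ → ℕ → List (List ℕ)
choices α zero = [ [] ]
choices α (suc t) = concatMap (λ a → map (a ∷_) (choices α t)) α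

plAlt : ℕ → ℕ → List ℕ → ℕ → List Bool → List Item
plAlt i₁ i₂ ps q g =
  concat (zipWith (λ b p → ([ i₁ ] ∶ ⌜ lit b (var p) ⌝) ∷ ([ i₂ ] ∶ ⌜ lit b (var p) ⌝) ∷ []) g ps)
  ++ ((i₁ ∷ i₂ ∷ []) ∶ var q) ∷ ((i₁ ∷ i₂ ∷ []) ∶ neg q) ∷ []

mlAlt : ℕ → ℕ → List MLF → MLF → List Bool → List Item
mlAlt i₁ i₂ φs ψ h =
  concat (zipWith (λ b φ → ([ i₁ ] ∶ ⌜ lit b φ ⌝) ∷ ([ i₂ ] ∶ ⌜ lit b φ ⌝) ∷ []) h φs)
  ++ ((i₁ ∷ i₂ ∷ []) ∶ ⌜ ψ ⌝) ∷ ((i₁ ∷ i₂ ∷ []) ∶ ⌜ dual ψ ⌝) ∷ []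

-- One rule application of T_L to branch B, yielding the list of extended
-- branches (one per alternative).
data Step (L : Logic) (B : Branch) : List Branch → Set where
  prop  : ∀ {α p} → α ∶ var p ∈ᴮ B →
          Step L B (map (λ i → ext B [ [ i ] ∶ var p ]) α)
  nprop : ∀ {α p} → α ∶ neg p ∈ᴮ B →
          Step L B (map (λ i → ext B [ [ i ] ∶ neg p ]) α)
  and   : ∀ {α φ ψ} → α ∶ (φ ∧ ψ) ∈ᴮ B →
          Step L B (ext B [ α ∶ φ ] ∷ ext B [ α ∶ ψ ] ∷ [])
  or    : ∀ {α φ ψ} → α ∶ (φ ∨ ψ) ∈ᴮ B → (β γ : Label) → β ⊆ α →
          (∀ x → (x ∈ γ) ⟺ ((x ∈ α) × (x ∉ β))) →
          Step L B (ext B [ β ∶ φ ] ∷ ext B [ γ ∶ ψ ] ∷ [])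
  uor   : ∀ {α φ ψ} → L ≡ MLuv → α ∶ (φ ⊻ ψ) ∈ᴮ B →
          Step L B (ext B ((α ∶ φ) ∷ (α ∶ ψ) ∷ []) ∷ [])
  splitP : ∀ {α ps q} → L ≡ MDL → Unique α → α ∶ pdep ps q ∈ᴮ B →
          Step L B (map (λ β → ext B [ β ∶ pdep ps q ]) (pairs α))
  splitE : ∀ {α φs ψ} → L ≡ EMDL → Unique α → α ∶ edep φs ψ ∈ᴮ B →
          Step L B (map (λ β → ext B [ β ∶ edep φs ψ ]) (pairs α))
  pldep : ∀ {i₁ i₂ ps q} → L ≡ MDL → (i₁ ∷ i₂ ∷ []) ∶ pdep ps q ∈ᴮ B →
          Step L B (map (λ g → ext B (plAlt i₁ i₂ ps q g)) (allSigns (length ps)))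
  mldep : ∀ {i₁ i₂ φs ψ} → L ≡ EMDL → (i₁ ∷ i₂ ∷ []) ∶ edep φs ψ ∈ᴮ B →
          Step L B (map (λ h → ext B (mlAlt i₁ i₂ φs ψ h)) (allSigns (length φs)))
  dia   : ∀ {α φ} → α ∶ (◇ φ) ∈ᴮ B → (ps : List (ℕ × ℕ)) →
          map proj₁ ps ≋ α → Unique (map proj₁ ps) →
          All (λ ij → (proj₁ ij 𝐑 proj₂ ij) ∈ items B) ps →
          Step L B (ext B [ map proj₂ ps ∶ φ ] ∷ [])
  box   : ∀ {α φ} → α ∶ (□ φ) ∈ᴮ B → ¬ BoxUsed B α φ →
          (is : List ℕ) → length is ≡ 2 ^ vrank φ → Unique is → All (Fresh B) is →
          Step L B (map (λ f → extBox B α φ (zipWith _𝐑_ f is ++ [ is ∶ φ ]))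
                        (choices α (2 ^ vrank φ)))

data ClosedBranch (B : Branch) : Set where
  c-lit  : ∀ {i p} → [ i ] ∶ var p ∈ᴮ B → [ i ] ∶ neg p ∈ᴮ B → ClosedBranch B
  c-empty : ∀ {ψ} → [] ∶ ψ ∈ᴮ B → ClosedBranch B
  c-pdep : ∀ {i ps q} → [ i ] ∶ pdep ps q ∈ᴮ B → ClosedBranch B
  c-edep : ∀ {i φs ψ} → [ i ] ∶ edep φs ψ ∈ᴮ B → ClosedBranch B

data ClosedTab (L : Logic) : Branch → Set where
  closed : ∀ {B} → ClosedBranch B → ClosedTab L B
  step   : ∀ {B bs} → Step L B bs → All (ClosedTab L) bs → ClosedTab L B

root : Form → Branch
root φ = ⟨ [ map suc (upTo (2 ^ vrank φ)) ∶ φ ] , [] ⟩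

module Submission where

-- Soundness is shown classically, by contraposition. Every formula φ is equivalent on teams to a
-- finite ⊻-disjunction of flat properties: T ⊨ φ iff T ⊆ P for some P in a list nf φ of at most
-- 2 ^ vrank φ predicates (a dependence atom =(χ₁,…,χₙ,ψ) contributes one predicate for each way of
-- making ψ a Boolean function of χ₁,…,χₙ). Hence satisfaction is downward closed, and a team that
-- falsifies φ contains a falsifying subteam of 2 ^ vrank φ worlds (repetitions allowed), one witness
-- against each P. A counterexample to φ therefore realises the root of every tableau for φ; each rule
-- application turns a realised branch into a realised alternative (for (□) the fresh labels name such
-- a small falsifying team of successors); and no closed branch is realisable.

open import Defs
open import Level using (0ℓ; Lift; lift; lower) renaming (suc to lsuc)
open import Axiom.ExcludedMiddle using (ExcludedMiddle)
open import Function using (_∘_; id)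
open import Data.Nat using (ℕ; zero; suc; _+_; _*_; _^_; _∸_; _≤_; _≟_)
open import Data.Nat.Properties
  using (≤-refl; ≤-trans; ≤-reflexive; *-mono-≤; +-mono-≤; ^-distribˡ-+-*; ^-monoʳ-≤; m≤m+n; m≤n+m;
         +-identityʳ; m+[n∸m]≡n; suc-injective; module ≤-Reasoning)
open import Data.Bool using (true; false)
open import Data.List
  using (List; []; _∷_; _++_; map; length; zipWith; replicate; [_]; concat; upTo; cartesianProductWith)
import Data.List.NonEmpty as L⁺
import Data.List.NonEmpty.Properties as L⁺
open import Data.List.Properties using (length-map; length-++; length-replicate; length-upTo; map-cong-local)
open import Data.List.Relation.Unary.Any using (Any; here; there)
import Data.List.Relation.Unary.Any as Any
import Data.List.Relation.Unary.Any.Properties as Any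
open import Data.List.Relation.Unary.All using (All; []; _∷_)
import Data.List.Relation.Unary.All as All
import Data.List.Relation.Unary.All.Properties as All
open import Data.List.Relation.Unary.Unique.Propositional using (Unique)
open import Data.List.Relation.Unary.AllPairs using ([]; _∷_)
import Data.List.Relation.Unary.Unique.Propositional.Properties as Unique
open import Data.List.Relation.Binary.Pointwise using (Pointwise; []; _∷_; Pointwise-length)
open import Data.List.Membership.Propositional using (_∈_; _∉_; find; lose)
open import Data.List.Membership.Propositional.Properties
  using (∈-map⁺; ∈-map⁻; ∈-++⁺ˡ; ∈-++⁺ʳ; ∈-cartesianProductWith⁻)
open import Data.List.Membership.DecPropositional _≟_ using (_∈?_)
import Data.List.Relation.Binary.Subset.Propositional.Properties as Subset
open import Data.Product as Product using (Σ; ∃; _×_; _,_; proj₁; proj₂)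
open import Data.Sum as Sum using (_⊎_; inj₁; inj₂)
open import Data.Empty using (⊥-elim)
open import Relation.Nullary using (¬_; Dec; yes; no)
import Relation.Nullary.Decidable as Dec
open import Relation.Nullary.Decidable using (decidable-stable)
open import Relation.Unary using (Pred; _⊆′_; _∩_; _∪_; ∁)
open import Relation.Binary.PropositionalEquality using (_≡_; _≢_; refl; sym; trans; cong; cong₂; subst; subst₂)

length-cartesianProductWith : ∀ {a b c} {A : Set a} {B : Set b} {C : Set c} (f : A → B → C) xs ys →
  length (cartesianProductWith f xs ys) ≡ length xs * length ys
length-cartesianProductWith f [] ys = refl
length-cartesianProductWith f (x ∷ xs) ys =
  trans (length-++ (map (f x) ys)) (cong₂ _+_ (length-map (f x) ys) (length-cartesianProductWith f xs ys))

length-cartesianProductWith-≤ : ∀ {a b c} {A : Set a} {B : Set b} {C : Set c} (f : A → B → C) xs ys {m n} →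
  length xs ≤ 2 ^ m → length ys ≤ 2 ^ n → length (cartesianProductWith f xs ys) ≤ 2 ^ (m + n)
length-cartesianProductWith-≤ f xs ys {m} {n} xs≤ ys≤ = begin
  length (cartesianProductWith f xs ys) ≡⟨ length-cartesianProductWith f xs ys ⟩
  length xs * length ys                 ≤⟨ *-mono-≤ xs≤ ys≤ ⟩
  2 ^ m * 2 ^ n                         ≡⟨ ^-distribˡ-+-* 2 m n ⟨
  2 ^ (m + n)                           ∎
  where open ≤-Reasoning

count⊻-⌜⌝ : ∀ χ → count⊻ ⌜ χ ⌝ ≡ 0
count⊻-⌜⌝ (var p) = refl
count⊻-⌜⌝ (neg p) = refl
count⊻-⌜⌝ (φ ∧ ψ) = cong₂ _+_ (count⊻-⌜⌝ φ) (count⊻-⌜⌝ ψ)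
count⊻-⌜⌝ (φ ∨ ψ) = cong₂ _+_ (count⊻-⌜⌝ φ) (count⊻-⌜⌝ ψ)
count⊻-⌜⌝ (◇ φ) = count⊻-⌜⌝ φ
count⊻-⌜⌝ (□ φ) = count⊻-⌜⌝ φ

count⊻-bigAnd : ∀ s φs z → count⊻ (bigAnd (zipWith (λ b φ → ⌜ lit b φ ⌝) s φs) z) ≡ count⊻ z
count⊻-bigAnd [] φs z = refl
count⊻-bigAnd (b ∷ s) [] z = refl
count⊻-bigAnd (b ∷ s) (φ ∷ φs) z = cong₂ _+_ (count⊻-⌜⌝ (lit b φ)) (count⊻-bigAnd s φs z)

count⊻-⋁ : ∀ {A : Set} (G : A → Form) → (∀ a → count⊻ (G a) ≡ 1) →
  ∀ x xs → count⊻ (L⁺.foldr₁ _∨_ (L⁺.map G (x L⁺.∷ xs))) ≡ suc (length xs)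
count⊻-⋁ G one x [] = one x
count⊻-⋁ G one x (y ∷ ys) = cong₂ _+_ (one x) (count⊻-⋁ G one y ys)

length-allSigns⁺ : ∀ n → L⁺.length (allSigns⁺ n) ≡ 2 ^ n
length-allSigns⁺ zero = refl
length-allSigns⁺ (suc n) =
  trans (L⁺.length-⁺++⁺ (L⁺.map (true ∷_) signs) (L⁺.map (false ∷_) signs))
        (cong₂ _+_ (trans (L⁺.length-map (true ∷_) signs) (length-allSigns⁺ n))
                   (trans (L⁺.length-map (false ∷_) signs)
                          (trans (length-allSigns⁺ n) (sym (+-identityʳ (2 ^ n))))))
  where signs = allSigns⁺ n

vrank-edep : ∀ φs ψ → vrank (edep φs ψ) ≡ 2 ^ length φs
vrank-edep φs ψ = trans (count⊻-⋁ _ one (L⁺.head signs) (L⁺.tail signs)) (length-allSigns⁺ (length φs))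
  where
  signs = allSigns⁺ (length φs)
  one : ∀ s → count⊻ (bigAnd (zipWith (λ b φ → ⌜ lit b φ ⌝) s φs) (⌜ ψ ⌝ ⊻ ⌜ dual ψ ⌝)) ≡ 1
  one s = trans (count⊻-bigAnd s φs _) (cong suc (cong₂ _+_ (count⊻-⌜⌝ ψ) (count⊻-⌜⌝ (dual ψ))))

∈-allSigns : ∀ g → g ∈ allSigns (length g)
∈-allSigns [] = here refl
∈-allSigns (true ∷ g) = ∈-++⁺ˡ (∈-map⁺ (true ∷_) (∈-allSigns g))
∈-allSigns (false ∷ g) = ∈-++⁺ʳ (map (true ∷_) (allSigns (length g))) (∈-map⁺ (false ∷_) (∈-allSigns g))

∈-choices : ∀ {α} fs → All (_∈ α) fs → fs ∈ choices α (length fs)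
∈-choices [] [] = here refl
∈-choices (j ∷ fs) (j∈α ∷ fs⊆α) = Any.concatMap⁺ _ (lose j∈α (∈-map⁺ (j ∷_) (∈-choices fs fs⊆α)))

pairs-cover : ∀ {α i j} → i ∈ α → j ∈ α → i ≢ j → Any (λ β → i ∈ β × j ∈ β) (pairs α)
pairs-cover (here refl) (here refl) i≢j = ⊥-elim (i≢j refl)
pairs-cover (here refl) (there j∈) _ = Any.++⁺ˡ (Any.map⁺ (lose j∈ (here refl , there (here refl))))
pairs-cover (there i∈) (here refl) _ = Any.++⁺ˡ (Any.map⁺ (lose i∈ (there (here refl) , here refl)))
pairs-cover {x ∷ xs} (there i∈) (there j∈) i≢j = Any.++⁺ʳ (map (λ y → x ∷ y ∷ []) xs) (pairs-cover i∈ j∈ i≢j)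

plAlt≡mlAlt : ∀ i₁ i₂ ps q g → plAlt i₁ i₂ ps q g ≡ mlAlt i₁ i₂ (map var ps) (var q) g
plAlt≡mlAlt i₁ i₂ [] q [] = refl
plAlt≡mlAlt i₁ i₂ [] q (b ∷ g) = refl
plAlt≡mlAlt i₁ i₂ (p ∷ ps) q [] = refl
plAlt≡mlAlt i₁ i₂ (p ∷ ps) q (b ∷ g) = cong (λ items → _ ∷ _ ∷ items) (plAlt≡mlAlt i₁ i₂ ps q g)

module _ {A : Set} where

  override : List ℕ → List A → (ℕ → A) → ℕ → A
  override (i ∷ is) (a ∷ as) f x with x ≟ i
  ... | yes _ = a
  ... | no _ = override is as f x
  override _ _ f x = f x

  override-∉ : ∀ is as f {x} → x ∉ is → override is as f x ≡ f x
  override-∉ [] as f x∉ = refl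
  override-∉ (i ∷ is) [] f x∉ = refl
  override-∉ (i ∷ is) (a ∷ as) f {x} x∉ with x ≟ i
  ... | yes x≡i = ⊥-elim (x∉ (here x≡i))
  ... | no _ = override-∉ is as f (x∉ ∘ there)

  map-override : ∀ is as f → Unique is → length is ≡ length as → map (override is as f) is ≡ as
  map-override [] [] f [] _ = refl
  map-override (i ∷ is) (a ∷ as) f (i∉is ∷ is-unique) len =
    cong₂ _∷_ head
      (trans (map-cong-local (All.map skip i∉is)) (map-override is as f is-unique (suc-injective len)))
    where
    head : override (i ∷ is) (a ∷ as) f i ≡ a
    head with i ≟ i
    ... | yes _ = refl
    ... | no i≢i = ⊥-elim (i≢i refl)
    skip : ∀ {j} → i ≢ j → override (i ∷ is) (a ∷ as) f j ≡ override is as f j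
    skip {j} i≢j with j ≟ i
    ... | yes j≡i = ⊥-elim (i≢j (sym j≡i))
    ... | no _ = refl

module Semantics (lem : ExcludedMiddle (lsuc 0ℓ)) (K : Kripke) where
  open Kripke K

  dec : (P : Set) → Dec P
  dec P = Dec.map′ lower lift lem

  stable : ∀ {P : Set} → ¬ ¬ P → P
  stable {P} = decidable-stable (dec P)

  ¬∀⇒∃¬ : ∀ {P : W → Set} → ¬ (∀ w → P w) → ∃ λ w → ¬ P w
  ¬∀⇒∃¬ ¬∀ = stable (λ ¬∃ → ¬∀ (λ w → stable (λ ¬p → ¬∃ (w , ¬p))))

  ¬→⇒×¬ : ∀ {P Q : Set} → ¬ (P → Q) → P × ¬ Q
  ¬→⇒×¬ ¬imp = stable (λ ¬p → ¬imp (⊥-elim ∘ ¬p)) , (λ q → ¬imp (λ _ → q))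

  ◇ᴾ □ᴾ : Pred W 0ℓ → Pred W 0ℓ
  ◇ᴾ P w = ∃ λ v → R w v × P v
  □ᴾ P w = ∀ v → R w v → P v

  ⟦_⟧ : MLF → Pred W 0ℓ
  ⟦ var p ⟧ = V p
  ⟦ neg p ⟧ = ∁ (V p)
  ⟦ φ ∧ ψ ⟧ = ⟦ φ ⟧ ∩ ⟦ ψ ⟧
  ⟦ φ ∨ ψ ⟧ = ⟦ φ ⟧ ∪ ⟦ ψ ⟧
  ⟦ ◇ φ ⟧ = ◇ᴾ ⟦ φ ⟧
  ⟦ □ φ ⟧ = □ᴾ ⟦ φ ⟧

  ⊆∩⇔ : ∀ {T P Q : Pred W 0ℓ} → (T ⊆′ P ∩ Q) ⟺ (T ⊆′ P × T ⊆′ Q)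
  ⊆∩⇔ = (λ h → (λ w t → proj₁ (h w t)) , (λ w t → proj₂ (h w t))) , (λ (h₁ , h₂) w t → h₁ w t , h₂ w t)

  succs⊆⇔⊆□ᴾ : ∀ {T : Team K} {P : Pred W 0ℓ} → (succs K T ⊆′ P) ⟺ (T ⊆′ □ᴾ P)
  succs⊆⇔⊆□ᴾ = (λ h w t v r → h v (w , t , r)) , (λ h v (w , t , r) → h w t v r)

  -- The ∨ and ◇ clauses of team semantics, for any satisfaction relation (shared by satML and sat).
  Split : (Team K → Set₁) → (Team K → Set₁) → Team K → Set₁
  Split S₁ S₂ T = Σ (Team K) λ T₁ → Σ (Team K) λ T₂ →
    (∀ w → T w → T₁ w ⊎ T₂ w) × (∀ w → T₁ w → T w) × (∀ w → T₂ w → T w) × S₁ T₁ × S₂ T₂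

  Image : (Team K → Set₁) → Team K → Set₁
  Image S T = Σ (Team K) λ T′ →
    (∀ w → T w → Σ W λ v → R w v × T′ v) × (∀ v → T′ v → Σ W λ w → T w × R w v) × S T′

  split-⊆ : ∀ {S₁ S₂ : Team K → Set₁} {T : Team K} {P Q : Pred W 0ℓ} →
    (∀ {T′} → T′ ⊆′ P → S₁ T′) → (∀ {T′} → T′ ⊆′ Q → S₂ T′) → T ⊆′ P ∪ Q → Split S₁ S₂ T
  split-⊆ {T = T} {P} {Q} sat₁ sat₂ T⊆P∪Q =
    T ∩ P , T ∩ Q , (λ w t → Sum.map (t ,_) (t ,_) (T⊆P∪Q w t)) , (λ _ → proj₁) , (λ _ → proj₁) ,
    sat₁ (λ _ → proj₂) , sat₂ (λ _ → proj₂)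

  ⊆-∪ : ∀ {T T₁ T₂ : Team K} {P Q : Pred W 0ℓ} → (∀ w → T w → T₁ w ⊎ T₂ w) → T₁ ⊆′ P → T₂ ⊆′ Q → T ⊆′ P ∪ Q
  ⊆-∪ cover T₁⊆P T₂⊆Q w t = Sum.map (T₁⊆P w) (T₂⊆Q w) (cover w t)

  image-⊆ : ∀ {S : Team K → Set₁} {T : Team K} {P : Pred W 0ℓ} →
    (∀ {T′} → T′ ⊆′ P → S T′) → T ⊆′ ◇ᴾ P → Image S T
  image-⊆ {T = T} {P} sat T⊆◇P =
    (λ v → ∃ λ w → T w × R w v × P v) , forth , back , sat (λ _ (_ , _ , _ , pv) → pv)
    where
    forth : ∀ w → T w → Σ W λ v → R w v × (∃ λ u → T u × R u v × P v)
    forth w t = let (v , r , pv) = T⊆◇P w t in v , r , (w , t , r , pv)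
    back : ∀ v → (∃ λ w → T w × R w v × P v) → Σ W λ w → T w × R w v
    back v (w , t , r , _) = w , t , r

  ⊆-◇ᴾ : ∀ {T T′ : Team K} {P : Pred W 0ℓ} → (∀ w → T w → Σ W λ v → R w v × T′ v) → T′ ⊆′ P → T ⊆′ ◇ᴾ P
  ⊆-◇ᴾ forth T′⊆P w t = let (v , r , t′) = forth w t in v , r , T′⊆P v t′

  satML⇔⊆⟦⟧ : ∀ χ {T} → satML K T χ ⟺ (T ⊆′ ⟦ χ ⟧)
  satML⇔⊆⟦⟧ (var p) = lower , lift
  satML⇔⊆⟦⟧ (neg p) = lower , lift
  satML⇔⊆⟦⟧ (φ ∧ ψ) =
    (λ (a , b) → proj₂ ⊆∩⇔ (proj₁ (satML⇔⊆⟦⟧ φ) a , proj₁ (satML⇔⊆⟦⟧ ψ) b)) ,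
    (λ h → proj₂ (satML⇔⊆⟦⟧ φ) (proj₁ (proj₁ ⊆∩⇔ h)) , proj₂ (satML⇔⊆⟦⟧ ψ) (proj₂ (proj₁ ⊆∩⇔ h)))
  satML⇔⊆⟦⟧ (φ ∨ ψ) =
    (λ (_ , _ , cover , _ , _ , s₁ , s₂) → ⊆-∪ cover (proj₁ (satML⇔⊆⟦⟧ φ) s₁) (proj₁ (satML⇔⊆⟦⟧ ψ) s₂)) ,
    split-⊆ (proj₂ (satML⇔⊆⟦⟧ φ)) (proj₂ (satML⇔⊆⟦⟧ ψ))
  satML⇔⊆⟦⟧ (◇ φ) = (λ (_ , forth , _ , s) → ⊆-◇ᴾ forth (proj₁ (satML⇔⊆⟦⟧ φ) s)) , image-⊆ (proj₂ (satML⇔⊆⟦⟧ φ))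
  satML⇔⊆⟦⟧ (□ φ) = proj₁ succs⊆⇔⊆□ᴾ ∘ proj₁ (satML⇔⊆⟦⟧ φ) , proj₂ (satML⇔⊆⟦⟧ φ) ∘ proj₂ succs⊆⇔⊆□ᴾ

  sat⌜⌝⇔satML : ∀ χ {T} → sat K T ⌜ χ ⌝ ⟺ satML K T χ
  sat⌜⌝⇔satML (var p) = id , id
  sat⌜⌝⇔satML (neg p) = id , id
  sat⌜⌝⇔satML (φ ∧ ψ) =
    Product.map (proj₁ (sat⌜⌝⇔satML φ)) (proj₁ (sat⌜⌝⇔satML ψ)) ,
    Product.map (proj₂ (sat⌜⌝⇔satML φ)) (proj₂ (sat⌜⌝⇔satML ψ))
  sat⌜⌝⇔satML (φ ∨ ψ) =
    (λ (T₁ , T₂ , c , i₁ , i₂ , s₁ , s₂) →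
       T₁ , T₂ , c , i₁ , i₂ , proj₁ (sat⌜⌝⇔satML φ) s₁ , proj₁ (sat⌜⌝⇔satML ψ) s₂) ,
    (λ (T₁ , T₂ , c , i₁ , i₂ , s₁ , s₂) →
       T₁ , T₂ , c , i₁ , i₂ , proj₂ (sat⌜⌝⇔satML φ) s₁ , proj₂ (sat⌜⌝⇔satML ψ) s₂)
  sat⌜⌝⇔satML (◇ φ) =
    (λ (T′ , forth , back , s) → T′ , forth , back , proj₁ (sat⌜⌝⇔satML φ) s) ,
    (λ (T′ , forth , back , s) → T′ , forth , back , proj₂ (sat⌜⌝⇔satML φ) s)
  sat⌜⌝⇔satML (□ φ) = sat⌜⌝⇔satML φ

  sat⌜⌝⇔⊆⟦⟧ : ∀ χ {T} → sat K T ⌜ χ ⌝ ⟺ (T ⊆′ ⟦ χ ⟧)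
  sat⌜⌝⇔⊆⟦⟧ χ = proj₁ (satML⇔⊆⟦⟧ χ) ∘ proj₁ (sat⌜⌝⇔satML χ) , proj₂ (sat⌜⌝⇔satML χ) ∘ proj₂ (satML⇔⊆⟦⟧ χ)

  ⟦dual⟧ : ∀ χ {w} → ⟦ dual χ ⟧ w ⟺ (¬ ⟦ χ ⟧ w)
  ⟦dual⟧ (var p) = id , id
  ⟦dual⟧ (neg p) = (λ v ¬v → ¬v v) , stable
  ⟦dual⟧ (φ ∧ ψ) {w} = to , from
    where
    to : ⟦ dual (φ ∧ ψ) ⟧ w → ¬ ⟦ φ ∧ ψ ⟧ w
    to (inj₁ d) (a , _) = proj₁ (⟦dual⟧ φ) d a
    to (inj₂ d) (_ , b) = proj₁ (⟦dual⟧ ψ) d b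
    from : ¬ ⟦ φ ∧ ψ ⟧ w → ⟦ dual (φ ∧ ψ) ⟧ w
    from ¬ab with dec (⟦ φ ⟧ w)
    ... | yes a = inj₂ (proj₂ (⟦dual⟧ ψ) (λ b → ¬ab (a , b)))
    ... | no ¬a = inj₁ (proj₂ (⟦dual⟧ φ) ¬a)
  ⟦dual⟧ (φ ∨ ψ) =
    (λ (d , e) → Sum.[ proj₁ (⟦dual⟧ φ) d , proj₁ (⟦dual⟧ ψ) e ]) ,
    (λ ¬ab → proj₂ (⟦dual⟧ φ) (¬ab ∘ inj₁) , proj₂ (⟦dual⟧ ψ) (¬ab ∘ inj₂))
  ⟦dual⟧ (◇ φ) =
    (λ d (v , r , a) → proj₁ (⟦dual⟧ φ) (d v r) a) ,
    (λ ¬◇ v r → proj₂ (⟦dual⟧ φ) (λ a → ¬◇ (v , r , a)))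
  ⟦dual⟧ (□ φ) =
    (λ (v , r , d) □a → proj₁ (⟦dual⟧ φ) d (□a v r)) ,
    (λ ¬□ → let (v , ¬[r→a]) = ¬∀⇒∃¬ ¬□ ; (r , ¬a) = ¬→⇒×¬ ¬[r→a] in v , r , proj₂ (⟦dual⟧ φ) ¬a)

  falsifying-lit : ∀ χ w → ∃ λ b → ¬ ⟦ lit b χ ⟧ w
  falsifying-lit χ w with dec (⟦ χ ⟧ w)
  ... | yes x = false , (λ d → proj₁ (⟦dual⟧ χ) d x)
  ... | no ¬x = true , ¬x

  AgreeOn : MLF → W → W → Set
  AgreeOn χ w v = ⟦ χ ⟧ w ⟺ ⟦ χ ⟧ v

  AgreeOn-lit : ∀ b χ {w v} → AgreeOn χ w v → AgreeOn (lit b χ) w v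
  AgreeOn-lit true χ agree = agree
  AgreeOn-lit false χ (to , from) =
    (λ d → proj₂ (⟦dual⟧ χ) (proj₁ (⟦dual⟧ χ) d ∘ from)) , (λ d → proj₂ (⟦dual⟧ χ) (proj₁ (⟦dual⟧ χ) d ∘ to))

  Agree⇔AgreeOn : ∀ χ {w v} → Agree K χ w v ⟺ AgreeOn χ w v
  Agree⇔AgreeOn χ = (λ (f , g) → to ∘ f ∘ from , to ∘ g ∘ from) , (λ (f , g) → from ∘ f ∘ to , from ∘ g ∘ to)
    where
    to : ∀ {u} → satML K (singleton K u) χ → ⟦ χ ⟧ u
    to s = proj₁ (satML⇔⊆⟦⟧ χ) s _ refl
    from : ∀ {u} → ⟦ χ ⟧ u → satML K (singleton K u) χ
    from x = proj₂ (satML⇔⊆⟦⟧ χ) λ { _ refl → x }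

  Determines : List MLF → MLF → Team K → Set
  Determines χs ψ T = ∀ {w v} → T w → T v → All (λ χ → AgreeOn χ w v) χs → AgreeOn ψ w v

  sat-edep⇔Determines : ∀ χs ψ {T} → sat K T (edep χs ψ) ⟺ Determines χs ψ T
  sat-edep⇔Determines χs ψ =
    (λ s w∈ v∈ agree → proj₁ (Agree⇔AgreeOn ψ) (s _ _ w∈ v∈ (All.map (λ {χ} → proj₂ (Agree⇔AgreeOn χ)) agree))) ,
    (λ d w v w∈ v∈ agree → proj₂ (Agree⇔AgreeOn ψ) (d w∈ v∈ (All.map (λ {χ} → proj₁ (Agree⇔AgreeOn χ)) agree)))

  sat-pdep⇔sat-edep : ∀ {T} ps q → sat K T (pdep ps q) ⟺ sat K T (edep (map var ps) (var q))
  sat-pdep⇔sat-edep ps q =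
    (λ s w v w∈ v∈ agree → s w v w∈ v∈ (All.map⁻ agree)) ,
    (λ s w v w∈ v∈ agree → s w v w∈ v∈ (All.map⁺ agree))

  sat-pdep⇔Determines : ∀ ps q {T} → sat K T (pdep ps q) ⟺ Determines (map var ps) (var q) T
  sat-pdep⇔Determines ps q =
    proj₁ (sat-edep⇔Determines (map var ps) (var q)) ∘ proj₁ (sat-pdep⇔sat-edep ps q) ,
    proj₂ (sat-pdep⇔sat-edep ps q) ∘ proj₂ (sat-edep⇔Determines (map var ps) (var q))

  Determines-singleton : ∀ χs ψ {w} → Determines χs ψ (_∈ [ w ])
  Determines-singleton χs ψ w∈ v∈ _ with Any.singleton⁻ w∈ | Any.singleton⁻ v∈
  ... | refl | refl = id , id

  Determines-pair : ∀ χs ψ {w v} →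
    (All (λ χ → AgreeOn χ w v) χs → AgreeOn ψ w v) → Determines χs ψ (_∈ w ∷ v ∷ [])
  Determines-pair χs ψ d (here refl) (here refl) _ = id , id
  Determines-pair χs ψ d (here refl) (there (here refl)) agree = d agree
  Determines-pair χs ψ d (there (here refl)) (here refl) agree = Product.swap (d (All.map Product.swap agree))
  Determines-pair χs ψ d (there (here refl)) (there (here refl)) _ = id , id
  Determines-pair χs ψ d (there (there ())) _ _
  Determines-pair χs ψ d _ (there (there ())) _

  Determines-pairs : ∀ χs ψ f {α} →
    All (λ β → Determines χs ψ (_∈ map f β)) (pairs α) → Determines χs ψ (_∈ map f α)
  Determines-pairs χs ψ f all w∈ v∈ agree with ∈-map⁻ f w∈ | ∈-map⁻ f v∈
  ... | i , i∈ , refl | j , j∈ , refl with i ≟ j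
  ...   | yes refl = id , id
  ...   | no i≢j with find (pairs-cover i∈ j∈ i≢j)
  ...     | β , β∈ , i∈β , j∈β = All.lookup all β∈ (∈-map⁺ f i∈β) (∈-map⁺ f j∈β) agree

  Determines-[] : ∀ ψ {T} → Determines [] ψ T ⟺ Any (T ⊆′_) (⟦ ψ ⟧ ∷ ∁ ⟦ ψ ⟧ ∷ [])
  Determines-[] ψ {T} = to , from
    where
    to : Determines [] ψ T → Any (T ⊆′_) (⟦ ψ ⟧ ∷ ∁ ⟦ ψ ⟧ ∷ [])
    to d with dec (T ⊆′ ⟦ ψ ⟧)
    ... | yes T⊆ψ = here T⊆ψ
    ... | no T⊈ψ = there (here (λ w w∈ ψw → T⊈ψ (λ v v∈ → proj₁ (d w∈ v∈ []) ψw)))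
    from : Any (T ⊆′_) (⟦ ψ ⟧ ∷ ∁ ⟦ ψ ⟧ ∷ []) → Determines [] ψ T
    from (here T⊆ψ) w∈ v∈ _ = (λ _ → T⊆ψ _ v∈) , (λ _ → T⊆ψ _ w∈)
    from (there (here T⊆¬ψ)) w∈ v∈ _ = ⊥-elim ∘ T⊆¬ψ _ w∈ , ⊥-elim ∘ T⊆¬ψ _ v∈

  Determines-∷ : ∀ χ χs ψ {T} →
    Determines (χ ∷ χs) ψ T ⟺ (Determines χs ψ (T ∩ ⟦ χ ⟧) × Determines χs ψ (T ∩ ∁ ⟦ χ ⟧))
  Determines-∷ χ χs ψ {T} = to , from
    where
    to : Determines (χ ∷ χs) ψ T → Determines χs ψ (T ∩ ⟦ χ ⟧) × Determines χs ψ (T ∩ ∁ ⟦ χ ⟧)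
    to d = (λ (w∈ , x) (v∈ , y) agree → d w∈ v∈ (((λ _ → y) , (λ _ → x)) ∷ agree)) ,
           (λ (w∈ , ¬x) (v∈ , ¬y) agree → d w∈ v∈ ((⊥-elim ∘ ¬x , ⊥-elim ∘ ¬y) ∷ agree))
    from : Determines χs ψ (T ∩ ⟦ χ ⟧) × Determines χs ψ (T ∩ ∁ ⟦ χ ⟧) → Determines (χ ∷ χs) ψ T
    from (d₁ , d₂) {w} w∈ v∈ ((x→y , y→x) ∷ agree) with dec (⟦ χ ⟧ w)
    ... | yes x = d₁ (w∈ , x) (v∈ , x→y x) agree
    ... | no ¬x = d₂ (w∈ , ¬x) (v∈ , ¬x ∘ y→x) agree

  branch : MLF → Pred W 0ℓ → Pred W 0ℓ → Pred W 0ℓ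
  branch χ P Q = (⟦ χ ⟧ ∩ P) ∪ (∁ ⟦ χ ⟧ ∩ Q)

  ⊆-branch : ∀ χ {T P Q : Pred W 0ℓ} → (T ⊆′ branch χ P Q) ⟺ (T ∩ ⟦ χ ⟧ ⊆′ P × T ∩ ∁ ⟦ χ ⟧ ⊆′ Q)
  ⊆-branch χ {T} {P} {Q} = to , from
    where
    to : T ⊆′ branch χ P Q → T ∩ ⟦ χ ⟧ ⊆′ P × T ∩ ∁ ⟦ χ ⟧ ⊆′ Q
    to h = (λ w (w∈ , x) → Sum.[ proj₂ , (λ (¬x , _) → ⊥-elim (¬x x)) ] (h w w∈)) ,
           (λ w (w∈ , ¬x) → Sum.[ (λ (x , _) → ⊥-elim (¬x x)) , proj₂ ] (h w w∈))
    from : T ∩ ⟦ χ ⟧ ⊆′ P × T ∩ ∁ ⟦ χ ⟧ ⊆′ Q → T ⊆′ branch χ P Q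
    from (h₁ , h₂) w w∈ with dec (⟦ χ ⟧ w)
    ... | yes x = inj₁ (x , h₁ w (w∈ , x))
    ... | no ¬x = inj₂ (¬x , h₂ w (w∈ , ¬x))

  depNF : List MLF → MLF → List (Pred W 0ℓ)
  depNF [] ψ = ⟦ ψ ⟧ ∷ ∁ ⟦ ψ ⟧ ∷ []
  depNF (χ ∷ χs) ψ = cartesianProductWith (branch χ) (depNF χs ψ) (depNF χs ψ)

  Determines⇔depNF : ∀ χs ψ {T} → Determines χs ψ T ⟺ Any (T ⊆′_) (depNF χs ψ)
  Determines⇔depNF [] ψ = Determines-[] ψ
  Determines⇔depNF (χ ∷ χs) ψ = to , from
    where
    to : ∀ {T} → Determines (χ ∷ χs) ψ T → Any (T ⊆′_) (depNF (χ ∷ χs) ψ)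
    to d = let (d₁ , d₂) = proj₁ (Determines-∷ χ χs ψ) d in
      Any.cartesianProductWith⁺ (branch χ) (λ h₁ h₂ → proj₂ (⊆-branch χ) (h₁ , h₂))
        (proj₁ (Determines⇔depNF χs ψ) d₁) (proj₁ (Determines⇔depNF χs ψ) d₂)
    from : ∀ {T} → Any (T ⊆′_) (depNF (χ ∷ χs) ψ) → Determines (χ ∷ χs) ψ T
    from {T} a = let (a₁ , a₂) = Any.cartesianProductWith⁻ (branch χ) (proj₁ (⊆-branch χ {T})) _ _ a in
      proj₂ (Determines-∷ χ χs ψ) (proj₂ (Determines⇔depNF χs ψ) a₁ , proj₂ (Determines⇔depNF χs ψ) a₂)

  sat-edep⇔depNF : ∀ χs ψ {T} → sat K T (edep χs ψ) ⟺ Any (T ⊆′_) (depNF χs ψ)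
  sat-edep⇔depNF χs ψ =
    proj₁ (Determines⇔depNF χs ψ) ∘ proj₁ (sat-edep⇔Determines χs ψ) ,
    proj₂ (sat-edep⇔Determines χs ψ) ∘ proj₂ (Determines⇔depNF χs ψ)

  nf : Form → List (Pred W 0ℓ)
  nf (var p) = [ V p ]
  nf (neg p) = [ ∁ (V p) ]
  nf (φ ∧ ψ) = cartesianProductWith _∩_ (nf φ) (nf ψ)
  nf (φ ∨ ψ) = cartesianProductWith _∪_ (nf φ) (nf ψ)
  nf (φ ⊻ ψ) = nf φ ++ nf ψ
  nf (◇ φ) = map ◇ᴾ (nf φ)
  nf (□ φ) = map □ᴾ (nf φ)
  nf (pdep ps q) = depNF (map var ps) (var q)
  nf (edep φs ψ) = depNF φs ψ

  sat⇔nf : ∀ φ {T} → sat K T φ ⟺ Any (T ⊆′_) (nf φ)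
  sat⇔nf (var p) = here ∘ lower , lift ∘ Any.singleton⁻
  sat⇔nf (neg p) = here ∘ lower , lift ∘ Any.singleton⁻
  sat⇔nf (φ ∧ ψ) =
    (λ (a , b) → Any.cartesianProductWith⁺ _∩_ (λ h₁ h₂ → proj₂ ⊆∩⇔ (h₁ , h₂))
                   (proj₁ (sat⇔nf φ) a) (proj₁ (sat⇔nf ψ) b)) ,
    (λ x → let (a , b) = Any.cartesianProductWith⁻ _∩_ (proj₁ ⊆∩⇔) _ _ x in proj₂ (sat⇔nf φ) a , proj₂ (sat⇔nf ψ) b)
  sat⇔nf (φ ∨ ψ) =
    (λ (_ , _ , cover , _ , _ , s₁ , s₂) →
       Any.cartesianProductWith⁺ _∪_ (⊆-∪ cover) (proj₁ (sat⇔nf φ) s₁) (proj₁ (sat⇔nf ψ) s₂)) ,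
    (λ x → let (_ , C∈ , T⊆C) = find x ; (_ , _ , P∈ , Q∈ , C≡P∪Q) = ∈-cartesianProductWith⁻ _∪_ (nf φ) (nf ψ) C∈ in
       split-⊆ (proj₂ (sat⇔nf φ) ∘ lose P∈) (proj₂ (sat⇔nf ψ) ∘ lose Q∈) (subst (_ ⊆′_) C≡P∪Q T⊆C))
  sat⇔nf (φ ⊻ ψ) =
    Sum.[ Any.++⁺ˡ ∘ proj₁ (sat⇔nf φ) , Any.++⁺ʳ (nf φ) ∘ proj₁ (sat⇔nf ψ) ] ,
    Sum.map (proj₂ (sat⇔nf φ)) (proj₂ (sat⇔nf ψ)) ∘ Any.++⁻ (nf φ)
  sat⇔nf (◇ φ) =
    (λ (_ , forth , _ , s) → Any.map⁺ (Any.map (⊆-◇ᴾ forth) (proj₁ (sat⇔nf φ) s))) ,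
    (λ x → let (_ , P∈ , T⊆◇P) = find (Any.map⁻ x) in image-⊆ (proj₂ (sat⇔nf φ) ∘ lose P∈) T⊆◇P)
  sat⇔nf (□ φ) =
    Any.map⁺ ∘ Any.map (proj₁ succs⊆⇔⊆□ᴾ) ∘ proj₁ (sat⇔nf φ) ,
    proj₂ (sat⇔nf φ) ∘ Any.map (proj₂ succs⊆⇔⊆□ᴾ) ∘ Any.map⁻
  sat⇔nf (pdep ps q) =
    proj₁ (Determines⇔depNF (map var ps) (var q)) ∘ proj₁ (sat-pdep⇔Determines ps q) ,
    proj₂ (sat-pdep⇔Determines ps q) ∘ proj₂ (Determines⇔depNF (map var ps) (var q))
  sat⇔nf (edep φs ψ) = sat-edep⇔depNF φs ψ

  length-depNF : ∀ χs ψ → length (depNF χs ψ) ≤ 2 ^ 2 ^ length χs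
  length-depNF [] ψ = ≤-refl
  length-depNF (χ ∷ χs) ψ =
    ≤-trans (length-cartesianProductWith-≤ (branch χ) (depNF χs ψ) (depNF χs ψ) {k} {k}
               (length-depNF χs ψ) (length-depNF χs ψ))
            (≤-reflexive (cong (λ m → 2 ^ (k + m)) (sym (+-identityʳ k))))
    where k = 2 ^ length χs

  length-nf : ∀ φ → length (nf φ) ≤ 2 ^ vrank φ
  length-nf (var p) = ≤-refl
  length-nf (neg p) = ≤-refl
  length-nf (φ ∧ ψ) =
    length-cartesianProductWith-≤ _∩_ (nf φ) (nf ψ) {vrank φ} {vrank ψ} (length-nf φ) (length-nf ψ)
  length-nf (φ ∨ ψ) =
    length-cartesianProductWith-≤ _∪_ (nf φ) (nf ψ) {vrank φ} {vrank ψ} (length-nf φ) (length-nf ψ)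
  length-nf (φ ⊻ ψ) = begin
    length (nf φ ++ nf ψ)       ≡⟨ length-++ (nf φ) ⟩
    length (nf φ) + length (nf ψ) ≤⟨ +-mono-≤ (length-nf φ) (length-nf ψ) ⟩
    2 ^ a + 2 ^ b               ≤⟨ +-mono-≤ (^-monoʳ-≤ 2 (m≤m+n a b)) (^-monoʳ-≤ 2 (m≤n+m b a)) ⟩
    2 ^ (a + b) + 2 ^ (a + b)   ≡⟨ cong (2 ^ (a + b) +_) (+-identityʳ (2 ^ (a + b))) ⟨
    2 ^ suc (a + b)             ∎
    where
    open ≤-Reasoning
    a = vrank φ
    b = vrank ψ
  length-nf (◇ φ) = ≤-trans (≤-reflexive (length-map ◇ᴾ (nf φ))) (length-nf φ)
  length-nf (□ φ) = ≤-trans (≤-reflexive (length-map □ᴾ (nf φ))) (length-nf φ)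
  length-nf (pdep ps q) =
    ≤-trans (length-depNF (map var ps) (var q)) (≤-reflexive (cong (2 ^_) (sym (vrank-edep (map var ps) (var q)))))
  length-nf (edep φs ψ) = ≤-trans (length-depNF φs ψ) (≤-reflexive (cong (2 ^_) (sym (vrank-edep φs ψ))))

  sat-∅ : ∀ φ {T} → (∀ w → ¬ T w) → sat K T φ
  sat-∅ (var p) T=∅ = lift (λ w w∈ → ⊥-elim (T=∅ w w∈))
  sat-∅ (neg p) T=∅ = lift (λ w w∈ → ⊥-elim (T=∅ w w∈))
  sat-∅ (φ ∧ ψ) T=∅ = sat-∅ φ T=∅ , sat-∅ ψ T=∅
  sat-∅ (φ ∨ ψ) {T} T=∅ = T , T , (λ _ → inj₁) , (λ _ → id) , (λ _ → id) , sat-∅ φ T=∅ , sat-∅ ψ T=∅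
  sat-∅ (φ ⊻ ψ) T=∅ = inj₁ (sat-∅ φ T=∅)
  sat-∅ (◇ φ) {T} T=∅ = T , (λ w w∈ → ⊥-elim (T=∅ w w∈)) , (λ w w∈ → ⊥-elim (T=∅ w w∈)) , sat-∅ φ T=∅
  sat-∅ (□ φ) T=∅ = sat-∅ φ (λ v (w , w∈ , _) → T=∅ w w∈)
  sat-∅ (pdep ps q) T=∅ = λ w _ w∈ → ⊥-elim (T=∅ w w∈)
  sat-∅ (edep φs ψ) T=∅ = λ w _ w∈ → ⊥-elim (T=∅ w w∈)

  sat-⊆ : ∀ φ {T T′ : Team K} → T′ ⊆′ T → sat K T φ → sat K T′ φ
  sat-⊆ φ T′⊆T = proj₂ (sat⇔nf φ) ∘ Any.map (λ T⊆P w w∈ → T⊆P w (T′⊆T w w∈)) ∘ proj₁ (sat⇔nf φ)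

  unsat⇒inhabited : ∀ φ {T} → ¬ sat K T φ → ∃ T
  unsat⇒inhabited φ ¬s = stable (λ ¬∃ → ¬s (sat-∅ φ (λ w w∈ → ¬∃ (w , w∈))))

  ¬⊆⇒witness : ∀ {T P : Pred W 0ℓ} → ¬ T ⊆′ P → ∃ λ w → T w × ¬ P w
  ¬⊆⇒witness T⊈P = let (w , ¬[w∈→Pw]) = ¬∀⇒∃¬ T⊈P in w , ¬→⇒×¬ ¬[w∈→Pw]

  witnesses : ∀ {T} Ps → ¬ Any (T ⊆′_) Ps →
    ∃ λ ws → All T ws × length ws ≡ length Ps × ¬ Any ((_∈ ws) ⊆′_) Ps
  witnesses [] _ = [] , [] , refl , λ ()
  witnesses (P ∷ Ps) ¬any with ¬⊆⇒witness (¬any ∘ here) | witnesses Ps (¬any ∘ there)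
  ... | w , w∈ , ¬Pw | ws , ws⊆T , len , ¬any′ = w ∷ ws , w∈ ∷ ws⊆T , cong suc len , ¬covered
    where
    ¬covered : ¬ Any ((_∈ w ∷ ws) ⊆′_) (P ∷ Ps)
    ¬covered (here ⊆P) = ¬Pw (⊆P w (here refl))
    ¬covered (there a) = ¬any′ (Any.map (λ ⊆P x x∈ → ⊆P x (there x∈)) a)

  -- One witness against each member of nf φ, padded by repetition.
  small-counterexample : ∀ φ {T} → ¬ sat K T φ →
    ∃ λ ws → length ws ≡ 2 ^ vrank φ × All T ws × ¬ sat K (_∈ ws) φ
  small-counterexample φ ¬s with witnesses (nf φ) (¬s ∘ proj₂ (sat⇔nf φ)) | unsat⇒inhabited φ ¬s
  ... | ws , ws⊆T , len , ¬fits | w₀ , w₀∈ =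
    padded , length-padded , All.++⁺ ws⊆T (All.replicate⁺ k w₀∈) , ¬sat-padded
    where
    k = 2 ^ vrank φ ∸ length ws
    padded = ws ++ replicate k w₀
    length-padded : length padded ≡ 2 ^ vrank φ
    length-padded = trans (length-++ ws) (trans (cong (length ws +_) (length-replicate k))
                      (m+[n∸m]≡n (≤-trans (≤-reflexive len) (length-nf φ))))
    ¬sat-padded : ¬ sat K (_∈ padded) φ
    ¬sat-padded = ¬fits ∘ proj₁ (sat⇔nf φ) ∘ sat-⊆ φ (λ _ → ∈-++⁺ˡ)

module Realisation (lem : ExcludedMiddle (lsuc 0ℓ)) (K : Kripke) where
  open Kripke K
  open Semantics lem K

  -- A branch is read as a description of a countermodel: under f : ℕ → W the label α names the
  -- team f[α], the item α : φ says that this team falsifies φ, and i R j says that R (f i) (f j).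
  Holds : (ℕ → W) → Item → Set₁
  Holds f (α ∶ φ) = ¬ sat K (_∈ map f α) φ
  Holds f (i 𝐑 j) = Lift (lsuc 0ℓ) (R (f i) (f j))

  record _Realises_ (f : ℕ → W) (B : Branch) : Set₁ where
    constructor realises
    field holds : All (Holds f) (items B)
  open _Realises_

  Realisable : Branch → Set₁
  Realisable B = Σ (ℕ → W) (_Realises B)

  ext-realisable : ∀ {f B xs} → f Realises B → All (Holds f) xs → Realisable (ext B xs)
  ext-realisable {f} r hs = f , realises (All.++⁺ (holds r) hs)

  labelled-fails : ∀ {f B} α φ → f Realises B → α ∶ φ ∈ᴮ B → ¬ sat K (_∈ map f α) φ
  labelled-fails {f} α φ r m s with find m
  ... | _ , it∈ , (β , refl , (β⊆α , _)) = All.lookup (holds r) it∈ (sat-⊆ φ (λ _ → Subset.map⁺ f β⊆α) s)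

  related : ∀ {f B i j} → f Realises B → (i 𝐑 j) ∈ items B → R (f i) (f j)
  related r m = lower (All.lookup (holds r) m)

  occurs : ∀ {B α φ i} → α ∶ φ ∈ᴮ B → i ∈ α → Any (Occurs i) (items B)
  occurs m i∈ = Any.map (λ { (β , refl , (_ , α⊆β)) → α⊆β i∈ }) m

  Holds-cong : ∀ {f g} its → (∀ i → Any (Occurs i) its → g i ≡ f i) → All (Holds f) its → All (Holds g) its
  Holds-cong [] _ [] = []
  Holds-cong ((α ∶ φ) ∷ its) g≡f (h ∷ hs) =
    subst (λ ws → ¬ sat K (_∈ ws) φ) (map-cong-local (All.tabulate (λ i∈ → sym (g≡f _ (here i∈))))) h ∷
    Holds-cong its (λ i → g≡f i ∘ there) hs
  Holds-cong ((i 𝐑 j) ∷ its) g≡f (lift r ∷ hs) =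
    lift (subst₂ R (sym (g≡f i (here (inj₁ refl)))) (sym (g≡f j (here (inj₂ refl)))) r) ∷
    Holds-cong its (λ k → g≡f k ∘ there) hs

  singleton-fails : ∀ {f i} χ → ¬ ⟦ χ ⟧ (f i) → Holds f ([ i ] ∶ ⌜ χ ⌝)
  singleton-fails χ ¬x s = ¬x (proj₁ (sat⌜⌝⇔⊆⟦⟧ χ) s _ (here refl))

  closed-unrealisable : ∀ {B f} → ClosedBranch B → ¬ f Realises B
  closed-unrealisable {f = f} (c-lit {i} {p} m₁ m₂) r with dec (V p (f i))
  ... | yes v = labelled-fails [ i ] (var p) r m₁ (lift λ x x∈ → subst (V p) (sym (Any.singleton⁻ x∈)) v)
  ... | no ¬v = labelled-fails [ i ] (neg p) r m₂ (lift λ x x∈ → subst (∁ (V p)) (sym (Any.singleton⁻ x∈)) ¬v)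
  closed-unrealisable (c-empty {ψ} m) r = labelled-fails [] ψ r m (sat-∅ ψ (λ _ ()))
  closed-unrealisable (c-pdep {i} {ps} {q} m) r =
    labelled-fails [ i ] (pdep ps q) r m
      (proj₂ (sat-pdep⇔Determines ps q) (Determines-singleton (map var ps) (var q)))
  closed-unrealisable (c-edep {i} {φs} {ψ} m) r =
    labelled-fails [ i ] (edep φs ψ) r m (proj₂ (sat-edep⇔Determines φs ψ) (Determines-singleton φs ψ))

  ¬⊆⇒singleton¬⊆ : ∀ (f : ℕ → W) α (Q : Pred W 0ℓ) → ¬ (_∈ map f α) ⊆′ Q → Any (λ i → ¬ (_∈ [ f i ]) ⊆′ Q) α
  ¬⊆⇒singleton¬⊆ f α Q ¬⊆ = Any.map (λ ¬Q ⊆Q → ¬Q (⊆Q _ (here refl))) (All.¬All⇒Any¬ (dec ∘ Q ∘ f) α (¬⊆ ∘ ⊆Q))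
    where
    ⊆Q : All (Q ∘ f) α → (_∈ map f α) ⊆′ Q
    ⊆Q all x x∈ with ∈-map⁻ f x∈
    ... | i , i∈ , refl = All.lookup all i∈

  split-cover : ∀ (f : ℕ → W) {α β γ} → (∀ x → (x ∈ γ) ⟺ ((x ∈ α) × (x ∉ β))) →
    ∀ w → w ∈ map f α → w ∈ map f β ⊎ w ∈ map f γ
  split-cover f {β = β} γ≡α∖β w w∈ with ∈-map⁻ f w∈
  ... | i , i∈α , refl with i ∈? β
  ...   | yes i∈β = inj₁ (∈-map⁺ f i∈β)
  ...   | no i∉β = inj₂ (∈-map⁺ f (proj₂ (γ≡α∖β i) (i∈α , i∉β)))

  ◇-step : ∀ {f B α} φ ps → map proj₁ ps ≋ α → All (λ ij → (proj₁ ij 𝐑 proj₂ ij) ∈ items B) ps →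
    f Realises B → sat K (_∈ map f (map proj₂ ps)) φ → sat K (_∈ map f α) (◇ φ)
  ◇-step {f} {B} {α} φ ps (ps⊆α , α⊆ps) links r s = _ , forth , back , s
    where
    forth : ∀ w → w ∈ map f α → Σ W λ v → R w v × v ∈ map f (map proj₂ ps)
    forth w w∈ with ∈-map⁻ f w∈
    ... | i , i∈α , refl with ∈-map⁻ proj₁ (α⊆ps i∈α)
    ...   | (_ , j) , ij∈ , refl = f j , related r (All.lookup links ij∈) , ∈-map⁺ f (∈-map⁺ proj₂ ij∈)
    back : ∀ v → v ∈ map f (map proj₂ ps) → Σ W λ w → w ∈ map f α × R w v
    back v v∈ with ∈-map⁻ f v∈
    ... | j , j∈ , refl with ∈-map⁻ proj₂ j∈
    ...   | (i , _) , ij∈ , refl = f i , ∈-map⁺ f (ps⊆α (∈-map⁺ proj₁ ij∈)) , related r (All.lookup links ij∈)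

  split-step : ∀ {f B α} δ χs ψ → (∀ {T} → sat K T δ ⟺ Determines χs ψ T) → f Realises B → α ∶ δ ∈ᴮ B →
    Any Realisable (map (λ β → ext B [ β ∶ δ ]) (pairs α))
  split-step {f} {α = α} δ χs ψ δ⇔ r m =
    Any.map⁺ (Any.map (λ ¬s → ext-realisable r (¬s ∷ [])) (All.¬All⇒Any¬ (λ _ → lem) (pairs α) ¬all))
    where
    ¬all : ¬ All (λ β → sat K (_∈ map f β) δ) (pairs α)
    ¬all all = labelled-fails α δ r m (proj₂ δ⇔ (Determines-pairs χs ψ f (All.map (proj₁ δ⇔) all)))

  lits-realised : ∀ {f} i₁ i₂ χs → All (λ χ → AgreeOn χ (f i₁) (f i₂)) χs →
    ∃ λ g → length g ≡ length χs ×
      All (Holds f) (concat (zipWith (λ b φ → ([ i₁ ] ∶ ⌜ lit b φ ⌝) ∷ ([ i₂ ] ∶ ⌜ lit b φ ⌝) ∷ []) g χs))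
  lits-realised i₁ i₂ [] [] = [] , refl , []
  lits-realised {f} i₁ i₂ (χ ∷ χs) (agree ∷ agrees) with falsifying-lit χ (f i₁) | lits-realised i₁ i₂ χs agrees
  ... | b , ¬lit | g , len , hs =
    b ∷ g , cong suc len ,
    singleton-fails {f} {i₁} (lit b χ) ¬lit ∷
    singleton-fails {f} {i₂} (lit b χ) (¬lit ∘ proj₂ (AgreeOn-lit b χ agree)) ∷ hs

  disagreement-realised : ∀ {f} i₁ i₂ ψ → ¬ AgreeOn ψ (f i₁) (f i₂) →
    All (Holds f) (((i₁ ∷ i₂ ∷ []) ∶ ⌜ ψ ⌝) ∷ ((i₁ ∷ i₂ ∷ []) ∶ ⌜ dual ψ ⌝) ∷ [])
  disagreement-realised i₁ i₂ ψ ¬agree = both-ψ ∷ both-dual ∷ []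
    where
    both-ψ : ¬ sat K _ ⌜ ψ ⌝
    both-ψ s = let ⊆ψ = proj₁ (sat⌜⌝⇔⊆⟦⟧ ψ) s in
      ¬agree ((λ _ → ⊆ψ _ (there (here refl))) , (λ _ → ⊆ψ _ (here refl)))
    both-dual : ¬ sat K _ ⌜ dual ψ ⌝
    both-dual s = let ⊆dual = proj₁ (sat⌜⌝⇔⊆⟦⟧ (dual ψ)) s in
      ¬agree (⊥-elim ∘ proj₁ (⟦dual⟧ ψ) (⊆dual _ (here refl)) ,
              ⊥-elim ∘ proj₁ (⟦dual⟧ ψ) (⊆dual _ (there (here refl))))

  dep-alternative : ∀ {f} i₁ i₂ χs ψ → ¬ Determines χs ψ (_∈ f i₁ ∷ f i₂ ∷ []) →
    ∃ λ g → length g ≡ length χs × All (Holds f) (mlAlt i₁ i₂ χs ψ g)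
  dep-alternative i₁ i₂ χs ψ ¬d with ¬→⇒×¬ (¬d ∘ Determines-pair χs ψ)
  ... | agrees , ¬agree with lits-realised i₁ i₂ χs agrees
  ...   | g , len , hs = g , len , All.++⁺ hs (disagreement-realised i₁ i₂ ψ ¬agree)

  predecessors : ∀ (f : ℕ → W) {α} ws → All (succs K (_∈ map f α)) ws →
    ∃ λ js → All (_∈ α) js × Pointwise (λ j w → R (f j) w) js ws
  predecessors f [] [] = [] , [] , []
  predecessors f (w ∷ ws) ((u , u∈ , r) ∷ rest) with ∈-map⁻ f u∈ | predecessors f ws rest
  ... | j , j∈ , refl | js , js⊆α , rs = j ∷ js , j∈ ∷ js⊆α , r ∷ rs

  links-realised : ∀ {g : ℕ → W} js is →
    Pointwise (λ j w → R (g j) w) js (map g is) → All (Holds g) (zipWith _𝐑_ js is)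
  links-realised [] [] [] = []
  links-realised (j ∷ js) (i ∷ is) (r ∷ rs) = lift r ∷ links-realised js is rs

  □-step : ∀ {f B α φ} → f Realises B → α ∶ (□ φ) ∈ᴮ B →
    ∀ is → length is ≡ 2 ^ vrank φ → Unique is → All (Fresh B) is →
    Any Realisable (map (λ js → extBox B α φ (zipWith _𝐑_ js is ++ [ is ∶ φ ])) (choices α (2 ^ vrank φ)))
  □-step {f} {B} {α} {φ} r m is len is-unique fresh
    with small-counterexample φ (labelled-fails α (□ φ) r m)
  ... | ws , len-ws , ws⊆succs , ¬s =
    Any.map⁺ (lose js∈choices (g , realises (All.++⁺ (Holds-cong (items B) unchanged (holds r))
                                               (All.++⁺ (links-realised js is links) (new-team ∷ [])))))
    where
    g = override is ws f
    unchanged : ∀ i → Any (Occurs i) (items B) → g i ≡ f i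
    unchanged i occ = override-∉ is ws f (λ i∈is → All.lookup fresh i∈is occ)
    α-unchanged : map g α ≡ map f α
    α-unchanged = map-cong-local (All.tabulate (λ i∈ → unchanged _ (occurs {B} {α} {□ φ} m i∈)))
    is↦ws : map g is ≡ ws
    is↦ws = map-override is ws f is-unique (trans len (sym len-ws))
    preds = predecessors g ws (subst (λ us → All (succs K (_∈ us)) ws) (sym α-unchanged) ws⊆succs)
    js = proj₁ preds
    links : Pointwise (λ j w → R (g j) w) js (map g is)
    links = subst (Pointwise _ js) (sym is↦ws) (proj₂ (proj₂ preds))
    js∈choices : js ∈ choices α (2 ^ vrank φ)
    js∈choices = subst (λ n → js ∈ choices α n) (trans (Pointwise-length (proj₂ (proj₂ preds))) len-ws)
                   (∈-choices js (proj₁ (proj₂ preds)))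
    new-team : Holds g (is ∶ φ)
    new-team = subst (λ us → ¬ sat K (_∈ us) φ) (sym is↦ws) ¬s

  step-sound : ∀ {L B bs f} → Step L B bs → f Realises B → Any Realisable bs
  step-sound {f = f} (prop {α} {p} m) r =
    Any.map⁺ (Any.map (λ ¬⊆ → ext-realisable r ((¬⊆ ∘ lower) ∷ []))
                      (¬⊆⇒singleton¬⊆ f α (V p) (labelled-fails α (var p) r m ∘ lift)))
  step-sound {f = f} (nprop {α} {p} m) r =
    Any.map⁺ (Any.map (λ ¬⊆ → ext-realisable r ((¬⊆ ∘ lower) ∷ []))
                      (¬⊆⇒singleton¬⊆ f α (∁ (V p)) (labelled-fails α (neg p) r m ∘ lift)))
  step-sound {f = f} (and {α} {φ} {ψ} m) r with lem {sat K (_∈ map f α) φ}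
  ... | yes s = there (here (ext-realisable r ((λ s′ → labelled-fails α (φ ∧ ψ) r m (s , s′)) ∷ [])))
  ... | no ¬s = here (ext-realisable r (¬s ∷ []))
  step-sound {f = f} (or {α} {φ} {ψ} m β γ β⊆α γ≡α∖β) r
    with lem {sat K (_∈ map f β) φ} | lem {sat K (_∈ map f γ) ψ}
  ... | no ¬s₁ | _ = here (ext-realisable r (¬s₁ ∷ []))
  ... | yes _ | no ¬s₂ = there (here (ext-realisable r (¬s₂ ∷ [])))
  ... | yes s₁ | yes s₂ = ⊥-elim (labelled-fails α (φ ∨ ψ) r m
        (_ , _ , split-cover f γ≡α∖β , (λ _ → Subset.map⁺ f β⊆α) ,
         (λ _ → Subset.map⁺ f (proj₁ ∘ proj₁ (γ≡α∖β _))) , s₁ , s₂))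
  step-sound (uor {α} {φ} {ψ} _ m) r =
    here (ext-realisable r ((labelled-fails α (φ ⊻ ψ) r m ∘ inj₁) ∷ (labelled-fails α (φ ⊻ ψ) r m ∘ inj₂) ∷ []))
  step-sound (splitP {α} {ps} {q} _ _ m) r =
    split-step (pdep ps q) (map var ps) (var q) (sat-pdep⇔Determines ps q) r m
  step-sound (splitE {α} {φs} {ψ} _ _ m) r =
    split-step (edep φs ψ) φs ψ (sat-edep⇔Determines φs ψ) r m
  step-sound (pldep {i₁} {i₂} {ps} {q} _ m) r
    with dep-alternative i₁ i₂ (map var ps) (var q)
           (labelled-fails _ (pdep ps q) r m ∘ proj₂ (sat-pdep⇔Determines ps q))
  ... | g , len , hs =
    Any.map⁺ (lose (subst (λ n → g ∈ allSigns n) (trans len (length-map var ps)) (∈-allSigns g))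
                   (ext-realisable r (subst (All _) (sym (plAlt≡mlAlt i₁ i₂ ps q g)) hs)))
  step-sound (mldep {i₁} {i₂} {φs} {ψ} _ m) r
    with dep-alternative i₁ i₂ φs ψ (labelled-fails _ (edep φs ψ) r m ∘ proj₂ (sat-edep⇔Determines φs ψ))
  ... | g , len , hs = Any.map⁺ (lose (subst (λ n → g ∈ allSigns n) len (∈-allSigns g)) (ext-realisable r hs))
  step-sound (dia {α} {φ} m ps ps≋α _ links) r =
    here (ext-realisable r ((labelled-fails α (◇ φ) r m ∘ ◇-step φ ps ps≋α links r) ∷ []))
  step-sound (box m _ is len is-unique fresh) r = □-step r m is len is-unique fresh

  mutual
    closedTab-unrealisable : ∀ {L B} → ClosedTab L B → ¬ Realisable B
    closedTab-unrealisable (closed c) (_ , r) = closed-unrealisable c r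
    closedTab-unrealisable (step s cs) (_ , r) = closedTabs-unrealisable cs (step-sound s r)

    closedTabs-unrealisable : ∀ {L bs} → All (ClosedTab L) bs → ¬ Any Realisable bs
    closedTabs-unrealisable (c ∷ _) (here realisable) = closedTab-unrealisable c realisable
    closedTabs-unrealisable (_ ∷ cs) (there realisable) = closedTabs-unrealisable cs realisable

  unsat⇒root-realisable : ∀ φ {T} → ¬ sat K T φ → Realisable (root φ)
  unsat⇒root-realisable φ ¬s with small-counterexample φ ¬s
  ... | ws , len , _ , ¬s′ =
    g , realises (subst (λ us → ¬ sat K (_∈ us) φ) (sym (map-override is ws _ is-unique length-is)) ¬s′ ∷ [])
    where
    N = 2 ^ vrank φ
    is = map suc (upTo N)
    g = override is ws (λ _ → nonempty)
    is-unique : Unique is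
    is-unique = Unique.map⁺ suc-injective (Unique.upTo⁺ N)
    length-is : length is ≡ length ws
    length-is = trans (length-map suc (upTo N)) (trans (length-upTo N) (sym len))

theorem8 : ExcludedMiddle (lsuc 0ℓ) →
    (L : Logic) (φ : Form) → InL L φ → ClosedTab L (root φ) → Valid φ
theorem8 lem L φ _ closedTab K T =
  decidable-stable lem (closedTab-unrealisable closedTab ∘ unsat⇒root-realisable φ)
  where open Realisation lem K
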